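{- For every integer $k\ge 0$ and real $x$, \[ \sum_{j=0}^{k} (-1)^{k-j}\genfrac{[}{]}{0pt}{}{k+1}{j+1} B_j(x) = k!\sum_{j=0}^{k}\frac{(-1)^{k-j}}{k+1-j}\binom{x-1}{j}. \]
   Context: $B_j(x)$ denotes the Bernoulli polynomials, defined by $\frac{te^{xt}}{e^t-1}=\sum_{k\ge0}B_k(x)\frac{t^k}{k!}$. $\genfrac{[}{]}{0pt}{}{n}{m}$ denotes the unsigned Stirling numbers of the first kind, so that $(-1)^{n-m}\genfrac{[}{]}{0pt}{}{n}{m}$ are the signed ones, defined by $x(x-1)\cdots(x-n+1)=\sum_{m=0}^n (-1)^{n-m}\genfrac{[}{]}{0pt}{}{n}{m}x^m$. For real $y$ and integer $m\ge0$, $\binom{y}{m}=\frac{y(y-1)\cdots(y-m+1)}{m!}$ ($m\ge1$), $\binom{y}{0}=1$.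
   Formalization: The variable x ranges over the rationals rather than the reals. -}

module Defs where

open import Data.Nat as ℕ using (ℕ; zero; suc; _∸_; _≤ᵇ_; _!)
open import Data.Nat.Properties using (_!≢0)
open import Data.Nat.Combinatorics using (_C_)
open import Data.Integer using (+_)
open import Data.Rational using (ℚ; _+_; _*_; _-_; -_; _/_; 0ℚ; 1ℚ)
open import Data.Bool using (if_then_else_)

sumTo : ℕ → (ℕ → ℚ) → ℚ
sumTo zero    f = f 0
sumTo (suc k) f = sumTo k f + f (suc k)

ℕ→ℚ : ℕ → ℚ
ℕ→ℚ n = (+ n) / 1

sgn : ℕ → ℚ
sgn zero    = 1ℚ
sgn (suc n) = - sgn n

pow : ℚ → ℕ → ℚ
pow y zero    = 1ℚ
pow y (suc n) = pow y n * y

stirling1 : ℕ → ℕ → ℕ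
stirling1 zero    zero    = 1
stirling1 zero    (suc m) = 0
stirling1 (suc n) zero    = 0
stirling1 (suc n) (suc m) = n ℕ.* stirling1 n (suc m) ℕ.+ stirling1 n m

-- Bernoulli numbers B_n = B_n(0) (convention B_1 = -1/2, from t/(e^t-1)):
-- B_0 = 1, and for m ≥ 0: B_{m+1} = -(1/(m+2)) Σ_{j=0}^{m} C(m+2, j) B_j.
-- bernTable n i = B_i for all i ≤ n.
bernTable : ℕ → ℕ → ℚ
bernTable zero    i = 1ℚ
bernTable (suc m) i =
  if i ≤ᵇ m then bernTable m i
  else (- ((+ 1) / suc (suc m))) * sumTo m (λ j → ℕ→ℚ (suc (suc m) C j) * bernTable m j)

bernoulliNum : ℕ → ℚ
bernoulliNum n = bernTable n n

-- Bernoulli polynomial B_n(x) = Σ_{k=0}^{n} C(n,k) B_k x^{n-k},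
-- equivalently the coefficients of t^n/n! in t e^{xt}/(e^t - 1).
bernoulliPoly : ℕ → ℚ → ℚ
bernoulliPoly n x = sumTo n (λ k → ℕ→ℚ (n C k) * bernoulliNum k * pow x (n ∸ k))

falling : ℚ → ℕ → ℚ
falling y zero    = 1ℚ
falling y (suc m) = falling y m * (y - ℕ→ℚ m)

binomQ : ℚ → ℕ → ℚ
binomQ y m = falling y m * ((+ 1) / (m !))
  where instance _ = m !≢0

{-# OPTIONS --safe #-}
module Submission where

-- Write s(n, m) = (-1)^(n-m) [n, m].  After multiplying by k + 1, the recurrence
-- (k + 1) s(k+1, i+1) = s(k+1, i) - s(k+2, i+1), the inversion s(k+1, i) = Σ_j C(j, i) s(k+2, j+1)
-- and B_j(x + 1) = Σ_i C(j, i) B_i(x) = B_j(x) + j x^(j-1) turn the left side into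
-- Σ_j s(k+2, j+1) j x^(j-1), the derivative of (x - 1)(x - 2) ⋯ (x - k - 1).  On the right,
-- Σ_j (-1)^(k-j) C(y, j) / (k + 1 - j) is the derivative of C(y, k + 1) in y, so (k + 1)! times
-- it is the derivative of y (y - 1) ⋯ (y - k).  Both derivatives obey the product rule as
-- recurrences in k, and they agree at y = x - 1.

open import Defs
open import Data.Bool using (true; false; T)
open import Data.Empty using (⊥-elim)
open import Data.Integer as ℤ using (+_)
import Data.Integer.Properties as ℤ
open import Data.Nat as ℕ using (ℕ; zero; suc; _∸_; _!; _≤_; _<_; z≤n; s≤s; _≤ᵇ_)
import Data.Nat.Properties as ℕ
open import Data.Nat.Properties using (_!≢0)
open import Data.Nat.Combinatorics
  using (_C_; nCk+nC[k+1]≡[n+1]C[k+1]; k>n⇒nCk≡0; nC1≡n; nCn≡1; nCk≡nC[n∸k])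
import Data.Nat.Coprimality as Coprime
open import Data.Rational using (ℚ; _+_; _*_; _-_; -_; _/_; 0ℚ; 1ℚ; mkℚ)
open import Data.Rational.Properties
open import Data.Rational.Solver using (module +-*-Solver)
open import Data.Sum using (inj₁; inj₂)
open import Data.Unit using (tt)
open import Relation.Binary.PropositionalEquality
  using (_≡_; refl; sym; trans; cong; cong₂; subst; module ≡-Reasoning)
open +-*-Solver using (solve; _:=_; con; _:+_; _:*_; _:-_; :-_)
open ≡-Reasoning

ℕ→ℚ≡mkℚ : ∀ n → ℕ→ℚ n ≡ mkℚ (+ n) 0 (Coprime.sym (Coprime.1-coprimeTo n))
ℕ→ℚ≡mkℚ n = normalize-coprime (Coprime.sym (Coprime.1-coprimeTo n))

ℕ→ℚ-suc : ∀ n → ℕ→ℚ (suc n) ≡ 1ℚ + ℕ→ℚ n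
ℕ→ℚ-suc n = sym (begin
  1ℚ + ℕ→ℚ n                    ≡⟨ cong (_+_ 1ℚ) (ℕ→ℚ≡mkℚ n) ⟩
  (+ 1 ℤ.+ (+ n ℤ.* + 1)) / 1   ≡⟨ cong (λ m → (+ 1 ℤ.+ m) / 1) (ℤ.*-identityʳ (+ n)) ⟩
  ℕ→ℚ (suc n)                   ∎)

ℕ→ℚ-+ : ∀ m n → ℕ→ℚ (m ℕ.+ n) ≡ ℕ→ℚ m + ℕ→ℚ n
ℕ→ℚ-+ zero    n = sym (+-identityˡ (ℕ→ℚ n))
ℕ→ℚ-+ (suc m) n = begin
  ℕ→ℚ (suc (m ℕ.+ n))    ≡⟨ ℕ→ℚ-suc (m ℕ.+ n) ⟩
  1ℚ + ℕ→ℚ (m ℕ.+ n)     ≡⟨ cong (_+_ 1ℚ) (ℕ→ℚ-+ m n) ⟩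
  1ℚ + (ℕ→ℚ m + ℕ→ℚ n)   ≡⟨ +-assoc 1ℚ (ℕ→ℚ m) (ℕ→ℚ n) ⟨
  1ℚ + ℕ→ℚ m + ℕ→ℚ n     ≡⟨ cong (_+ ℕ→ℚ n) (ℕ→ℚ-suc m) ⟨
  ℕ→ℚ (suc m) + ℕ→ℚ n    ∎

ℕ→ℚ-* : ∀ m n → ℕ→ℚ (m ℕ.* n) ≡ ℕ→ℚ m * ℕ→ℚ n
ℕ→ℚ-* zero    n = sym (*-zeroˡ (ℕ→ℚ n))
ℕ→ℚ-* (suc m) n = begin
  ℕ→ℚ (n ℕ.+ m ℕ.* n)
    ≡⟨ ℕ→ℚ-+ n (m ℕ.* n) ⟩
  ℕ→ℚ n + ℕ→ℚ (m ℕ.* n)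
    ≡⟨ cong (_+_ (ℕ→ℚ n)) (ℕ→ℚ-* m n) ⟩
  ℕ→ℚ n + ℕ→ℚ m * ℕ→ℚ n
    ≡⟨ solve 2 (λ m n → n :+ m :* n := (con 1ℚ :+ m) :* n) refl (ℕ→ℚ m) (ℕ→ℚ n) ⟩
  (1ℚ + ℕ→ℚ m) * ℕ→ℚ n
    ≡⟨ cong (_* ℕ→ℚ n) (ℕ→ℚ-suc m) ⟨
  ℕ→ℚ (suc m) * ℕ→ℚ n ∎

ℕ→ℚ-inverseʳ : ∀ n .{{_ : ℕ.NonZero n}} → ℕ→ℚ n * ((+ 1) / n) ≡ 1ℚ
ℕ→ℚ-inverseʳ (suc n) = begin
  ℕ→ℚ (suc n) * ((+ 1) / suc n)
    ≡⟨ cong₂ _*_ (ℕ→ℚ≡mkℚ (suc n)) (normalize-coprime (Coprime.1-coprimeTo (suc n))) ⟩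
  p * mkℚ (+ 1) n (Coprime.1-coprimeTo (suc n))
    ≡⟨ *-inverseʳ p ⟩
  1ℚ ∎
  where p = mkℚ (+ suc n) 0 (Coprime.sym (Coprime.1-coprimeTo (suc n)))

ℕ→ℚ-suc-*-cancelˡ : ∀ n {p q} → ℕ→ℚ (suc n) * p ≡ ℕ→ℚ (suc n) * q → p ≡ q
ℕ→ℚ-suc-*-cancelˡ n {p} {q} eq = begin
  p             ≡⟨ undo p ⟨
  r * (N * p)   ≡⟨ cong (r *_) eq ⟩
  r * (N * q)   ≡⟨ undo q ⟩
  q             ∎
  where
  N = ℕ→ℚ (suc n)
  r = (+ 1) / suc n
  undo : ∀ p → r * (N * p) ≡ p
  undo p = begin
    r * (N * p)   ≡⟨ *-assoc r N p ⟨
    r * N * p     ≡⟨ cong (_* p) (trans (*-comm r N) (ℕ→ℚ-inverseʳ (suc n))) ⟩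
    1ℚ * p        ≡⟨ *-identityˡ p ⟩
    p             ∎

-- Finite sums

sumTo-cong : ∀ n {f g : ℕ → ℚ} → (∀ i → i ≤ n → f i ≡ g i) → sumTo n f ≡ sumTo n g
sumTo-cong zero    f≗g = f≗g 0 z≤n
sumTo-cong (suc n) f≗g =
  cong₂ _+_ (sumTo-cong n (λ i i≤n → f≗g i (ℕ.m≤n⇒m≤1+n i≤n))) (f≗g (suc n) ℕ.≤-refl)

sumTo-distrib-+ : ∀ n (f g : ℕ → ℚ) → sumTo n (λ i → f i + g i) ≡ sumTo n f + sumTo n g
sumTo-distrib-+ zero    f g = refl
sumTo-distrib-+ (suc n) f g = begin
  sumTo n (λ i → f i + g i) + (f (suc n) + g (suc n))
    ≡⟨ cong (_+ (f (suc n) + g (suc n))) (sumTo-distrib-+ n f g) ⟩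
  sumTo n f + sumTo n g + (f (suc n) + g (suc n))
    ≡⟨ solve 4 (λ a b c d → a :+ b :+ (c :+ d) := a :+ c :+ (b :+ d)) refl
         (sumTo n f) (sumTo n g) (f (suc n)) (g (suc n)) ⟩
  sumTo n f + f (suc n) + (sumTo n g + g (suc n)) ∎

*-distribˡ-sumTo : ∀ n c (f : ℕ → ℚ) → c * sumTo n f ≡ sumTo n (λ i → c * f i)
*-distribˡ-sumTo zero    c f = refl
*-distribˡ-sumTo (suc n) c f =
  trans (*-distribˡ-+ c (sumTo n f) (f (suc n))) (cong (_+ c * f (suc n)) (*-distribˡ-sumTo n c f))

*-distribʳ-sumTo : ∀ n c (f : ℕ → ℚ) → sumTo n f * c ≡ sumTo n (λ i → f i * c)
*-distribʳ-sumTo n c f = begin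
  sumTo n f * c             ≡⟨ *-comm (sumTo n f) c ⟩
  c * sumTo n f             ≡⟨ *-distribˡ-sumTo n c f ⟩
  sumTo n (λ i → c * f i)   ≡⟨ sumTo-cong n (λ i _ → *-comm c (f i)) ⟩
  sumTo n (λ i → f i * c)   ∎

sumTo-neg : ∀ n (f : ℕ → ℚ) → sumTo n (λ i → - f i) ≡ - sumTo n f
sumTo-neg n f = begin
  sumTo n (λ i → - f i)          ≡⟨ sumTo-cong n (λ i _ → neg≡-1* (f i)) ⟩
  sumTo n (λ i → (- 1ℚ) * f i)   ≡⟨ *-distribˡ-sumTo n (- 1ℚ) f ⟨
  (- 1ℚ) * sumTo n f             ≡⟨ neg≡-1* (sumTo n f) ⟨
  - sumTo n f                    ∎
  where
  neg≡-1* : ∀ p → - p ≡ (- 1ℚ) * p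
  neg≡-1* = solve 1 (λ p → :- p := con (- 1ℚ) :* p) refl

sumTo-distrib-- : ∀ n (f g : ℕ → ℚ) → sumTo n (λ i → f i - g i) ≡ sumTo n f - sumTo n g
sumTo-distrib-- n f g =
  trans (sumTo-distrib-+ n f (λ i → - g i)) (cong (_+_ (sumTo n f)) (sumTo-neg n g))

sumTo-head : ∀ n (f : ℕ → ℚ) → sumTo (suc n) f ≡ f 0 + sumTo n (λ i → f (suc i))
sumTo-head zero    f = refl
sumTo-head (suc n) f =
  trans (cong (_+ f (suc (suc n))) (sumTo-head n f)) (+-assoc (f 0) _ _)

sumTo-extend : ∀ {n m} (f : ℕ → ℚ) → n ≤ m → (∀ i → n < i → f i ≡ 0ℚ) →
               sumTo m f ≡ sumTo n f
sumTo-extend {m = zero}  f z≤n   vanish = refl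
sumTo-extend {m = suc m} f n≤1+m vanish with ℕ.m≤n⇒m<n∨m≡n n≤1+m
... | inj₂ refl       = refl
... | inj₁ (s≤s n≤m) =
  trans (cong₂ _+_ (sumTo-extend f n≤m vanish) (vanish (suc m) (s≤s n≤m))) (+-identityʳ _)

sumTo-comm : ∀ n m (f : ℕ → ℕ → ℚ) →
             sumTo n (λ i → sumTo m (λ j → f i j)) ≡ sumTo m (λ j → sumTo n (λ i → f i j))
sumTo-comm zero    m f = refl
sumTo-comm (suc n) m f = begin
  sumTo n (λ i → sumTo m (f i)) + sumTo m (f (suc n))
    ≡⟨ cong (_+ sumTo m (f (suc n))) (sumTo-comm n m f) ⟩
  sumTo m (λ j → sumTo n (λ i → f i j)) + sumTo m (f (suc n))
    ≡⟨ sumTo-distrib-+ m _ _ ⟨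
  sumTo m (λ j → sumTo (suc n) (λ i → f i j)) ∎

ℕ→ℚ-C-vanishes : ∀ {n k} → n < k → ℕ→ℚ (n C k) ≡ 0ℚ
ℕ→ℚ-C-vanishes n<k = cong ℕ→ℚ (k>n⇒nCk≡0 n<k)

ℕ→ℚ-pascal : ∀ n k → ℕ→ℚ (suc n C suc k) ≡ ℕ→ℚ (n C k) + ℕ→ℚ (n C suc k)
ℕ→ℚ-pascal n k = trans (cong ℕ→ℚ (sym (nCk+nC[k+1]≡[n+1]C[k+1] n k))) (ℕ→ℚ-+ (n C k) (n C suc k))

sumTo-binomial-swap : ∀ n (q f : ℕ → ℚ) →
  sumTo n (λ i → sumTo n (λ j → ℕ→ℚ (j C i) * q j) * f i)
    ≡ sumTo n (λ j → q j * sumTo j (λ i → ℕ→ℚ (j C i) * f i))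
sumTo-binomial-swap n q f = begin
  sumTo n (λ i → sumTo n (λ j → ℕ→ℚ (j C i) * q j) * f i)
    ≡⟨ sumTo-cong n (λ i _ → *-distribʳ-sumTo n (f i) _) ⟩
  sumTo n (λ i → sumTo n (λ j → ℕ→ℚ (j C i) * q j * f i))
    ≡⟨ sumTo-comm n n _ ⟩
  sumTo n (λ j → sumTo n (λ i → ℕ→ℚ (j C i) * q j * f i))
    ≡⟨ sumTo-cong n inner ⟩
  sumTo n (λ j → q j * sumTo j (λ i → ℕ→ℚ (j C i) * f i)) ∎
  where
  inner : ∀ j → j ≤ n →
          sumTo n (λ i → ℕ→ℚ (j C i) * q j * f i) ≡ q j * sumTo j (λ i → ℕ→ℚ (j C i) * f i)
  inner j j≤n = begin
    sumTo n (λ i → ℕ→ℚ (j C i) * q j * f i)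
      ≡⟨ sumTo-cong n (λ i _ → solve 3 (λ c q f → c :* q :* f := q :* (c :* f)) refl
                                  (ℕ→ℚ (j C i)) (q j) (f i)) ⟩
    sumTo n (λ i → q j * (ℕ→ℚ (j C i) * f i))
      ≡⟨ *-distribˡ-sumTo n (q j) _ ⟨
    q j * sumTo n (λ i → ℕ→ℚ (j C i) * f i)
      ≡⟨ cong (q j *_) (sumTo-extend (λ i → ℕ→ℚ (j C i) * f i) j≤n (λ i j<i →
           trans (cong (_* f i) (ℕ→ℚ-C-vanishes j<i)) (*-zeroˡ (f i)))) ⟩
    q j * sumTo j (λ i → ℕ→ℚ (j C i) * f i) ∎

-- Appell sequences and Bernoulli polynomials

-- bernoulliPoly n x is definitionally appell bernoulliNum n x.
appell : (ℕ → ℚ) → ℕ → ℚ → ℚ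
appell a n x = sumTo n (λ k → ℕ→ℚ (n C k) * a k * pow x (n ∸ k))

appell-cong : ∀ {a b : ℕ → ℚ} n x → (∀ i → i ≤ n → a i ≡ b i) → appell a n x ≡ appell b n x
appell-cong n x a≗b =
  sumTo-cong n (λ i i≤n → cong (λ c → ℕ→ℚ (n C i) * c * pow x (n ∸ i)) (a≗b i i≤n))

appell-distrib-+ : ∀ (a b : ℕ → ℚ) n x → appell (λ i → a i + b i) n x ≡ appell a n x + appell b n x
appell-distrib-+ a b n x = trans (sumTo-cong n (λ i _ → distrib i)) (sumTo-distrib-+ n _ _)
  where
  distrib : ∀ i → ℕ→ℚ (n C i) * (a i + b i) * pow x (n ∸ i)
                  ≡ ℕ→ℚ (n C i) * a i * pow x (n ∸ i) + ℕ→ℚ (n C i) * b i * pow x (n ∸ i)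
  distrib i = solve 4 (λ c a b p → c :* (a :+ b) :* p := c :* a :* p :+ c :* b :* p) refl
                (ℕ→ℚ (n C i)) (a i) (b i) (pow x (n ∸ i))

appell-suc : ∀ (a : ℕ → ℚ) n x → appell a (suc n) x ≡ x * appell a n x + appell (λ i → a (suc i)) n x
appell-suc a n x = begin
  appell a (suc n) x
    ≡⟨ sumTo-head n _ ⟩
  lead + sumTo n (λ i → ℕ→ℚ (suc n C suc i) * a (suc i) * pow x (n ∸ i))
    ≡⟨ cong (_+_ lead) (trans (sumTo-cong n (λ i _ → pascal i)) (sumTo-distrib-+ n _ _)) ⟩
  lead + (appell a′ n x + rest)
    ≡⟨ solve 3 (λ l c r → l :+ (c :+ r) := l :+ r :+ c) refl lead (appell a′ n x) rest ⟩
  lead + rest + appell a′ n x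
    ≡⟨ cong (_+ appell a′ n x) x*appell ⟨
  x * appell a n x + appell a′ n x ∎
  where
  a′ : ℕ → ℚ
  a′ i = a (suc i)
  lead = 1ℚ * a 0 * pow x (suc n)
  rest = sumTo n (λ i → ℕ→ℚ (n C suc i) * a (suc i) * pow x (n ∸ i))
  pascal : ∀ i → ℕ→ℚ (suc n C suc i) * a (suc i) * pow x (n ∸ i)
                 ≡ ℕ→ℚ (n C i) * a (suc i) * pow x (n ∸ i)
                   + ℕ→ℚ (n C suc i) * a (suc i) * pow x (n ∸ i)
  pascal i = trans (cong (λ c → c * a (suc i) * pow x (n ∸ i)) (ℕ→ℚ-pascal n i))
                   (solve 4 (λ c d a p → (c :+ d) :* a :* p := c :* a :* p :+ d :* a :* p) refl
                      (ℕ→ℚ (n C i)) (ℕ→ℚ (n C suc i)) (a (suc i)) (pow x (n ∸ i)))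
  term : ℕ → ℚ
  term i = ℕ→ℚ (n C i) * a i * pow x (suc n ∸ i)
  x*term : ∀ i → i ≤ n → x * (ℕ→ℚ (n C i) * a i * pow x (n ∸ i)) ≡ term i
  x*term i i≤n = trans
    (solve 4 (λ x c a p → x :* (c :* a :* p) := c :* a :* (p :* x)) refl
       x (ℕ→ℚ (n C i)) (a i) (pow x (n ∸ i)))
    (cong (λ m → ℕ→ℚ (n C i) * a i * pow x m) (sym (ℕ.+-∸-assoc 1 i≤n)))
  term-vanishes : ∀ i → n < i → term i ≡ 0ℚ
  term-vanishes i n<i =
    trans (cong (λ c → c * a i * pow x (suc n ∸ i)) (ℕ→ℚ-C-vanishes n<i))
          (solve 2 (λ a p → con 0ℚ :* a :* p := con 0ℚ) refl (a i) (pow x (suc n ∸ i)))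
  x*appell : x * appell a n x ≡ lead + rest
  x*appell = begin
    x * appell a n x     ≡⟨ trans (*-distribˡ-sumTo n x _) (sumTo-cong n x*term) ⟩
    sumTo n term         ≡⟨ sumTo-extend term (ℕ.n≤1+n n) term-vanishes ⟨
    sumTo (suc n) term   ≡⟨ sumTo-head n term ⟩
    lead + rest          ∎

appell-+ : ∀ (a : ℕ → ℚ) n x y → appell (λ i → appell a i x) n y ≡ appell a n (x + y)
appell-+ a zero    x y = trans (*-identityʳ _) (*-identityˡ _)
appell-+ a (suc n) x y = begin
  appell (λ i → appell a i x) (suc n) y
    ≡⟨ appell-suc (λ i → appell a i x) n y ⟩
  y * appell (λ i → appell a i x) n y + appell (λ i → appell a (suc i) x) n y
    ≡⟨ cong₂ (λ p q → y * p + q) (appell-+ a n x y) (appell-cong n y (λ i _ → appell-suc a i x)) ⟩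
  y * A + appell (λ i → x * appell a i x + appell a′ i x) n y
    ≡⟨ cong (_+_ (y * A)) (appell-distrib-+ _ _ n y) ⟩
  y * A + (appell (λ i → x * appell a i x) n y + appell (λ i → appell a′ i x) n y)
    ≡⟨ cong₂ (λ p q → y * A + (p + q)) scale (appell-+ a′ n x y) ⟩
  y * A + (x * A + appell a′ n (x + y))
    ≡⟨ solve 4 (λ x y c d → y :* c :+ (x :* c :+ d) := (x :+ y) :* c :+ d) refl x y A (appell a′ n (x + y)) ⟩
  (x + y) * A + appell a′ n (x + y)
    ≡⟨ appell-suc a n (x + y) ⟨
  appell a (suc n) (x + y) ∎
  where
  a′ : ℕ → ℚ
  a′ i = a (suc i)
  A = appell a n (x + y)
  scale : appell (λ i → x * appell a i x) n y ≡ x * A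
  scale = begin
    appell (λ i → x * appell a i x) n y
      ≡⟨ sumTo-cong n (λ i _ → solve 4 (λ c x b p → c :* (x :* b) :* p := x :* (c :* b :* p)) refl
                                  (ℕ→ℚ (n C i)) x (appell a i x) (pow y (n ∸ i))) ⟩
    sumTo n (λ i → x * (ℕ→ℚ (n C i) * appell a i x * pow y (n ∸ i)))
      ≡⟨ *-distribˡ-sumTo n x _ ⟨
    x * appell (λ i → appell a i x) n y
      ≡⟨ cong (x *_) (appell-+ a n x y) ⟩
    x * A ∎

*-pow-1ℚ : ∀ p n → p * pow 1ℚ n ≡ p
*-pow-1ℚ p zero    = *-identityʳ p
*-pow-1ℚ p (suc n) = trans (cong (p *_) (*-identityʳ (pow 1ℚ n))) (*-pow-1ℚ p n)

bernTable-stable : ∀ {n i} → i ≤ n → bernTable n i ≡ bernoulliNum i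
bernTable-stable {zero}  z≤n   = refl
bernTable-stable {suc m} {i} i≤1+m with ℕ.m≤n⇒m<n∨m≡n i≤1+m
... | inj₂ refl = refl
... | inj₁ (s≤s i≤m) with i ≤ᵇ m | ℕ.≤⇒≤ᵇ i≤m
...   | true | _ = bernTable-stable i≤m

bernoulliNum-recurrence : ∀ m → sumTo (suc m) (λ l → ℕ→ℚ (suc (suc m) C l) * bernoulliNum l) ≡ 0ℚ
bernoulliNum-recurrence m = begin
  S + ℕ→ℚ (suc (suc m) C suc m) * bernTable (suc m) (suc m)
    ≡⟨ cong₂ (λ c b → S + ℕ→ℚ c * b) C[m+2,m+1]≡m+2 B[m+1] ⟩
  S + N * (- r * S)
    ≡⟨ solve 3 (λ s n r → s :+ n :* (:- r :* s) := s :- (n :* r) :* s) refl S N r ⟩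
  S - (N * r) * S
    ≡⟨ cong (λ c → S - c * S) (ℕ→ℚ-inverseʳ (suc (suc m))) ⟩
  S - 1ℚ * S
    ≡⟨ solve 1 (λ s → s :- con 1ℚ :* s := con 0ℚ) refl S ⟩
  0ℚ ∎
  where
  S = sumTo m (λ l → ℕ→ℚ (suc (suc m) C l) * bernoulliNum l)
  N = ℕ→ℚ (suc (suc m))
  r = (+ 1) / suc (suc m)
  C[m+2,m+1]≡m+2 : suc (suc m) C suc m ≡ suc (suc m)
  C[m+2,m+1]≡m+2 = begin
    suc (suc m) C suc m                   ≡⟨ nCk≡nC[n∸k] (ℕ.n≤1+n (suc m)) ⟩
    suc (suc m) C (suc (suc m) ∸ suc m)   ≡⟨ cong (suc (suc m) C_) (ℕ.m+n∸n≡m 1 (suc m)) ⟩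
    suc (suc m) C 1                       ≡⟨ nC1≡n (suc (suc m)) ⟩
    suc (suc m)                           ∎
  B[m+1] : bernTable (suc m) (suc m) ≡ - r * S
  B[m+1] with suc m ≤ᵇ m in m+1≤ᵇm
  ... | true  = ⊥-elim (ℕ.n≮n m (ℕ.≤ᵇ⇒≤ (suc m) m (subst T (sym m+1≤ᵇm) tt)))
  ... | false = cong (λ s → - r * s)
                  (sumTo-cong m (λ l l≤m → cong (ℕ→ℚ (suc (suc m) C l) *_) (bernTable-stable l≤m)))

δ₁ : ℕ → ℚ
δ₁ 1 = 1ℚ
δ₁ _ = 0ℚ

bernoulliPoly-1 : ∀ n → bernoulliPoly n 1ℚ ≡ bernoulliNum n + δ₁ n
bernoulliPoly-1 zero          = refl
bernoulliPoly-1 (suc zero)    = refl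
bernoulliPoly-1 (suc (suc m)) = begin
  sumTo (suc m) term + term (suc (suc m))
    ≡⟨ cong₂ _+_ (trans (sumTo-cong (suc m) (λ l _ → drop-pow l)) (bernoulliNum-recurrence m)) top ⟩
  0ℚ + bernoulliNum (suc (suc m))
    ≡⟨ +-comm 0ℚ (bernoulliNum (suc (suc m))) ⟩
  bernoulliNum (suc (suc m)) + 0ℚ ∎
  where
  term : ℕ → ℚ
  term l = ℕ→ℚ (suc (suc m) C l) * bernoulliNum l * pow 1ℚ (suc (suc m) ∸ l)
  drop-pow : ∀ l → term l ≡ ℕ→ℚ (suc (suc m) C l) * bernoulliNum l
  drop-pow l = *-pow-1ℚ _ (suc (suc m) ∸ l)
  top : term (suc (suc m)) ≡ bernoulliNum (suc (suc m))
  top = begin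
    term (suc (suc m))
      ≡⟨ drop-pow (suc (suc m)) ⟩
    ℕ→ℚ (suc (suc m) C suc (suc m)) * bernoulliNum (suc (suc m))
      ≡⟨ cong (λ c → ℕ→ℚ c * bernoulliNum (suc (suc m))) (nCn≡1 (suc (suc m))) ⟩
    1ℚ * bernoulliNum (suc (suc m))
      ≡⟨ *-identityˡ _ ⟩
    bernoulliNum (suc (suc m)) ∎

appell-δ₁ : ∀ n x → appell δ₁ n x ≡ ℕ→ℚ n * pow x (n ∸ 1)
appell-δ₁ zero    x = refl
appell-δ₁ (suc n) x = begin
  appell δ₁ (suc n) x
    ≡⟨ sumTo-head n term ⟩
  term 0 + sumTo n (λ i → term (suc i))
    ≡⟨ cong (_+_ (term 0)) (sumTo-extend {m = n} (λ i → term (suc i)) z≤n vanishes) ⟩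
  1ℚ * 0ℚ * pow x (suc n) + ℕ→ℚ (suc n C 1) * 1ℚ * pow x n
    ≡⟨ cong (λ c → 1ℚ * 0ℚ * pow x (suc n) + ℕ→ℚ c * 1ℚ * pow x n) (nC1≡n (suc n)) ⟩
  1ℚ * 0ℚ * pow x (suc n) + ℕ→ℚ (suc n) * 1ℚ * pow x n
    ≡⟨ solve 3 (λ p c q → con 1ℚ :* con 0ℚ :* p :+ c :* con 1ℚ :* q := c :* q) refl
         (pow x (suc n)) (ℕ→ℚ (suc n)) (pow x n) ⟩
  ℕ→ℚ (suc n) * pow x n ∎
  where
  term : ℕ → ℚ
  term k = ℕ→ℚ (suc n C k) * δ₁ k * pow x (suc n ∸ k)
  vanishes : ∀ i → 0 < i → term (suc i) ≡ 0ℚ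
  vanishes (suc i) _ = trans (cong (_* pow x (n ∸ suc i)) (*-zeroʳ (ℕ→ℚ (suc n C suc (suc i)))))
                             (*-zeroˡ (pow x (n ∸ suc i)))

bernoulliPoly-+1 : ∀ n x → bernoulliPoly n (x + 1ℚ) ≡ bernoulliPoly n x + ℕ→ℚ n * pow x (n ∸ 1)
bernoulliPoly-+1 n x = begin
  appell bernoulliNum n (x + 1ℚ)              ≡⟨ cong (appell bernoulliNum n) (+-comm x 1ℚ) ⟩
  appell bernoulliNum n (1ℚ + x)              ≡⟨ appell-+ bernoulliNum n 1ℚ x ⟨
  appell (λ i → bernoulliPoly i 1ℚ) n x       ≡⟨ appell-cong n x (λ i _ → bernoulliPoly-1 i) ⟩
  appell (λ i → bernoulliNum i + δ₁ i) n x    ≡⟨ appell-distrib-+ bernoulliNum δ₁ n x ⟩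
  bernoulliPoly n x + appell δ₁ n x           ≡⟨ cong (_+_ (bernoulliPoly n x)) (appell-δ₁ n x) ⟩
  bernoulliPoly n x + ℕ→ℚ n * pow x (n ∸ 1)   ∎

binomial-sum-bernoulliPoly : ∀ n x →
  sumTo n (λ i → ℕ→ℚ (n C i) * bernoulliPoly i x) ≡ bernoulliPoly n (x + 1ℚ)
binomial-sum-bernoulliPoly n x = begin
  sumTo n (λ i → ℕ→ℚ (n C i) * bernoulliPoly i x)
    ≡⟨ sumTo-cong n (λ i _ → sym (*-pow-1ℚ _ (n ∸ i))) ⟩
  appell (λ i → bernoulliPoly i x) n 1ℚ
    ≡⟨ appell-+ bernoulliNum n x 1ℚ ⟩
  bernoulliPoly n (x + 1ℚ) ∎

-- Stirling numbers of the first kind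

sgn-suc-∸ : ∀ {m n} → m ≤ n → sgn (suc n ∸ m) ≡ - sgn (n ∸ m)
sgn-suc-∸ m≤n = cong sgn (ℕ.+-∸-assoc 1 m≤n)

signedStirling1 : ℕ → ℕ → ℚ
signedStirling1 zero    zero    = 1ℚ
signedStirling1 zero    (suc m) = 0ℚ
signedStirling1 (suc n) zero    = 0ℚ
signedStirling1 (suc n) (suc m) = signedStirling1 n m - ℕ→ℚ n * signedStirling1 n (suc m)

stirling1-vanishes : ∀ {n m} → n < m → stirling1 n m ≡ 0
stirling1-vanishes {zero}  {suc m} _ = refl
stirling1-vanishes {suc n} {suc m} (s≤s n<m)
  rewrite stirling1-vanishes (ℕ.m≤n⇒m≤1+n n<m) | stirling1-vanishes n<m | ℕ.*-zeroʳ n = refl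

signedStirling1-vanishes : ∀ {n m} → n < m → signedStirling1 n m ≡ 0ℚ
signedStirling1-vanishes {zero}  {suc m} _ = refl
signedStirling1-vanishes {suc n} {suc m} (s≤s n<m)
  rewrite signedStirling1-vanishes (ℕ.m≤n⇒m≤1+n n<m) | signedStirling1-vanishes n<m =
    solve 1 (λ n → con 0ℚ :- n :* con 0ℚ := con 0ℚ) refl (ℕ→ℚ n)

sgn-*-stirling1 : ∀ n m → sgn (n ∸ m) * ℕ→ℚ (stirling1 n m) ≡ signedStirling1 n m
sgn-*-stirling1 zero    zero    = refl
sgn-*-stirling1 zero    (suc m) = refl
sgn-*-stirling1 (suc n) zero    = *-zeroʳ (sgn (suc n))
sgn-*-stirling1 (suc n) (suc m) = begin
  σ * ℕ→ℚ (n ℕ.* stirling1 n (suc m) ℕ.+ stirling1 n m)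
    ≡⟨ cong (σ *_) (trans (ℕ→ℚ-+ (n ℕ.* stirling1 n (suc m)) (stirling1 n m))
                          (cong (_+ b) (ℕ→ℚ-* n (stirling1 n (suc m))))) ⟩
  σ * (N * a + b)
    ≡⟨ solve 4 (λ σ N a b → σ :* (N :* a :+ b) := σ :* b :+ N :* (σ :* a)) refl σ N a b ⟩
  σ * b + N * (σ * a)
    ≡⟨ cong₂ (λ p q → p + N * q) (sgn-*-stirling1 n m) sign-flip ⟩
  s n m + N * (- (sgn (n ∸ suc m) * a))
    ≡⟨ cong (λ q → s n m + N * - q) (sgn-*-stirling1 n (suc m)) ⟩
  s n m + N * (- s n (suc m))
    ≡⟨ solve 3 (λ s N t → s :+ N :* (:- t) := s :- N :* t) refl (s n m) N (s n (suc m)) ⟩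
  s n m - N * s n (suc m) ∎
  where
  s = signedStirling1
  σ = sgn (n ∸ m)
  N = ℕ→ℚ n
  a = ℕ→ℚ (stirling1 n (suc m))
  b = ℕ→ℚ (stirling1 n m)
  sign-flip : σ * a ≡ - (sgn (n ∸ suc m) * a)
  sign-flip with ℕ.<-≤-connex m n
  ... | inj₁ m<n = trans (cong (_* a) (sgn-suc-∸ m<n)) (sym (neg-distribˡ-* (sgn (n ∸ suc m)) a))
  ... | inj₂ n≤m rewrite stirling1-vanishes (s≤s n≤m) =
    solve 2 (λ σ τ → σ :* con 0ℚ := :- (τ :* con 0ℚ)) refl σ (sgn (n ∸ suc m))

n*signedStirling1[n,0]≡0 : ∀ n → ℕ→ℚ n * signedStirling1 n 0 ≡ 0ℚ
n*signedStirling1[n,0]≡0 zero    = refl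
n*signedStirling1[n,0]≡0 (suc n) = *-zeroʳ (ℕ→ℚ (suc n))

binomial-sum-signedStirling1 : ∀ n i →
  sumTo n (λ j → ℕ→ℚ (j C i) * signedStirling1 (suc n) (suc j)) ≡ signedStirling1 n i
binomial-sum-signedStirling1 zero    zero    = refl
binomial-sum-signedStirling1 zero    (suc i) = refl
binomial-sum-signedStirling1 (suc n) i = begin
  sumTo (suc n) (λ j → ℕ→ℚ (j C i) * s (suc (suc n)) (suc j))
    ≡⟨ trans (sumTo-cong (suc n) (λ j _ → expand j)) (sumTo-distrib-- (suc n) _ _) ⟩
  sumTo (suc n) (λ j → ℕ→ℚ (j C i) * s (suc n) j) - sumTo (suc n) (λ j → N * term i j)
    ≡⟨ cong₂ _-_ drop-head (trans (sym (*-distribˡ-sumTo (suc n) N _)) (cong (N *_) extended-IH)) ⟩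
  shifted i - N * s n i
    ≡⟨ pascal-step i ⟩
  s (suc n) i ∎
  where
  s = signedStirling1
  N = ℕ→ℚ (suc n)
  term : ℕ → ℕ → ℚ
  term i j = ℕ→ℚ (j C i) * s (suc n) (suc j)
  shifted : ℕ → ℚ
  shifted i = sumTo n (λ j → ℕ→ℚ (suc j C i) * s (suc n) (suc j))
  expand : ∀ j → ℕ→ℚ (j C i) * s (suc (suc n)) (suc j) ≡ ℕ→ℚ (j C i) * s (suc n) j - N * term i j
  expand j = solve 4 (λ c a N b → c :* (a :- N :* b) := c :* a :- N :* (c :* b)) refl
               (ℕ→ℚ (j C i)) (s (suc n) j) N (s (suc n) (suc j))
  drop-head : sumTo (suc n) (λ j → ℕ→ℚ (j C i) * s (suc n) j) ≡ shifted i
  drop-head = trans (sumTo-head n _) (trans (cong (_+ shifted i) (*-zeroʳ (ℕ→ℚ (0 C i)))) (+-identityˡ _))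
  extended-IH : sumTo (suc n) (term i) ≡ s n i
  extended-IH = trans
    (sumTo-extend (term i) (ℕ.n≤1+n n) (λ j n<j →
       trans (cong (ℕ→ℚ (j C i) *_) (signedStirling1-vanishes (s≤s n<j))) (*-zeroʳ (ℕ→ℚ (j C i)))))
    (binomial-sum-signedStirling1 n i)
  pascal-step : ∀ i → shifted i - N * s n i ≡ s (suc n) i
  pascal-step zero = begin
    shifted 0 - N * s n 0
      ≡⟨ cong₂ (λ p c → p - c * s n 0) (binomial-sum-signedStirling1 n 0) (ℕ→ℚ-suc n) ⟩
    s n 0 - (1ℚ + ℕ→ℚ n) * s n 0
      ≡⟨ solve 2 (λ a m → a :- (con 1ℚ :+ m) :* a := :- (m :* a)) refl (s n 0) (ℕ→ℚ n) ⟩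
    - (ℕ→ℚ n * s n 0)
      ≡⟨ cong -_ (n*signedStirling1[n,0]≡0 n) ⟩
    0ℚ ∎
  pascal-step (suc i) = begin
    shifted (suc i) - N * s n (suc i)
      ≡⟨ cong₂ (λ p c → p - c * s n (suc i)) split (ℕ→ℚ-suc n) ⟩
    s n i + s n (suc i) - (1ℚ + ℕ→ℚ n) * s n (suc i)
      ≡⟨ solve 3 (λ a b m → a :+ b :- (con 1ℚ :+ m) :* b := a :- m :* b) refl
           (s n i) (s n (suc i)) (ℕ→ℚ n) ⟩
    s n i - ℕ→ℚ n * s n (suc i) ∎
    where
    split : shifted (suc i) ≡ s n i + s n (suc i)
    split = begin
      shifted (suc i)
        ≡⟨ sumTo-cong n (λ j _ → trans (cong (_* s (suc n) (suc j)) (ℕ→ℚ-pascal j i))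
                                       (*-distribʳ-+ (s (suc n) (suc j)) (ℕ→ℚ (j C i)) _)) ⟩
      sumTo n (λ j → term i j + term (suc i) j)
        ≡⟨ sumTo-distrib-+ n _ _ ⟩
      sumTo n (term i) + sumTo n (term (suc i))
        ≡⟨ cong₂ _+_ (binomial-sum-signedStirling1 n i) (binomial-sum-signedStirling1 n (suc i)) ⟩
      s n i + s n (suc i) ∎

-- Polynomials as coefficient sequences

poly : ℕ → (ℕ → ℚ) → ℚ → ℚ
poly n a x = sumTo n (λ i → a i * pow x i)

deriv : (ℕ → ℚ) → ℕ → ℚ
deriv a i = ℕ→ℚ (suc i) * a (suc i)

timesXMinus : ℚ → (ℕ → ℚ) → ℕ → ℚ
timesXMinus c a zero    = 0ℚ - c * a 0
timesXMinus c a (suc i) = a i - c * a (suc i)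

poly-timesXMinus : ∀ n (a : ℕ → ℚ) c x → a (suc n) ≡ 0ℚ →
                   poly (suc n) (timesXMinus c a) x ≡ poly n a x * (x - c)
poly-timesXMinus n a c x top≡0 = begin
  poly (suc n) (timesXMinus c a) x
    ≡⟨ trans (sumTo-cong (suc n) (λ i _ → split i)) (sumTo-distrib-- (suc n) _ _) ⟩
  sumTo (suc n) shifted - sumTo (suc n) (λ i → c * (a i * pow x i))
    ≡⟨ cong₂ _-_ x*poly (trans (sym (*-distribˡ-sumTo (suc n) c _)) (cong (c *_) drop-top)) ⟩
  x * poly n a x - c * poly n a x
    ≡⟨ solve 3 (λ x c p → x :* p :- c :* p := p :* (x :- c)) refl x c (poly n a x) ⟩
  poly n a x * (x - c) ∎
  where
  shifted : ℕ → ℚ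
  shifted zero    = 0ℚ
  shifted (suc i) = a i * pow x (suc i)
  split : ∀ i → timesXMinus c a i * pow x i ≡ shifted i - c * (a i * pow x i)
  split zero    = solve 3 (λ c a p → (con 0ℚ :- c :* a) :* p := con 0ℚ :- c :* (a :* p)) refl c (a 0) (pow x 0)
  split (suc i) = solve 4 (λ b c a p → (b :- c :* a) :* p := b :* p :- c :* (a :* p)) refl
                    (a i) c (a (suc i)) (pow x (suc i))
  x*poly : sumTo (suc n) shifted ≡ x * poly n a x
  x*poly = begin
    sumTo (suc n) shifted
      ≡⟨ trans (sumTo-head n shifted) (+-identityˡ _) ⟩
    sumTo n (λ i → a i * (pow x i * x))
      ≡⟨ sumTo-cong n (λ i _ → solve 3 (λ a p x → a :* (p :* x) := x :* (a :* p)) refl (a i) (pow x i) x) ⟩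
    sumTo n (λ i → x * (a i * pow x i))
      ≡⟨ *-distribˡ-sumTo n x _ ⟨
    x * poly n a x ∎
  drop-top : sumTo (suc n) (λ i → a i * pow x i) ≡ poly n a x
  drop-top = trans (cong (λ t → poly n a x + t * pow x (suc n)) top≡0)
                   (solve 2 (λ p q → p :+ con 0ℚ :* q := p) refl (poly n a x) (pow x (suc n)))

deriv-timesXMinus : ∀ c (a : ℕ → ℚ) i → deriv (timesXMinus c a) i ≡ a i + timesXMinus c (deriv a) i
deriv-timesXMinus c a zero    =
  solve 3 (λ c a b → con 1ℚ :* (a :- c :* b) := a :+ (con 0ℚ :- c :* (con 1ℚ :* b))) refl c (a 0) (a 1)
deriv-timesXMinus c a (suc i) = begin
  ℕ→ℚ (suc (suc i)) * (a (suc i) - c * a (suc (suc i)))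
    ≡⟨ cong (_* (a (suc i) - c * a (suc (suc i)))) (ℕ→ℚ-suc (suc i)) ⟩
  (1ℚ + M) * (a (suc i) - c * a (suc (suc i)))
    ≡⟨ solve 4 (λ m c a b → (con 1ℚ :+ m) :* (a :- c :* b)
                            := a :+ (m :* a :- c :* ((con 1ℚ :+ m) :* b))) refl
         M c (a (suc i)) (a (suc (suc i))) ⟩
  a (suc i) + (M * a (suc i) - c * ((1ℚ + M) * a (suc (suc i))))
    ≡⟨ cong (λ m → a (suc i) + (M * a (suc i) - c * (m * a (suc (suc i))))) (ℕ→ℚ-suc (suc i)) ⟨
  a (suc i) + timesXMinus c (deriv a) (suc i) ∎
  where M = ℕ→ℚ (suc i)

sumTo-derivative : ∀ n (a : ℕ → ℚ) x →
  sumTo (suc n) (λ j → a j * (ℕ→ℚ j * pow x (j ∸ 1))) ≡ poly n (deriv a) x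
sumTo-derivative n a x = begin
  sumTo (suc n) (λ j → a j * (ℕ→ℚ j * pow x (j ∸ 1)))
    ≡⟨ sumTo-head n _ ⟩
  a 0 * (0ℚ * 1ℚ) + sumTo n (λ j → a (suc j) * (ℕ→ℚ (suc j) * pow x j))
    ≡⟨ cong₂ _+_ (solve 1 (λ a → a :* (con 0ℚ :* con 1ℚ) := con 0ℚ) refl (a 0))
                 (sumTo-cong n (λ j _ → solve 3 (λ a m p → a :* (m :* p) := m :* a :* p) refl
                                           (a (suc j)) (ℕ→ℚ (suc j)) (pow x j))) ⟩
  0ℚ + poly n (deriv a) x
    ≡⟨ +-identityˡ _ ⟩
  poly n (deriv a) x ∎

-- The derivative of y ↦ falling y m, by the product rule.
fallingDeriv : ℚ → ℕ → ℚ
fallingDeriv y zero    = 0ℚ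
fallingDeriv y (suc m) = fallingDeriv y m * (y - ℕ→ℚ m) + falling y m

stirlingCoeffs : ℕ → ℕ → ℚ
stirlingCoeffs n i = signedStirling1 (suc n) (suc i)

stirlingCoeffs-suc : ∀ n i → stirlingCoeffs (suc n) i ≡ timesXMinus (ℕ→ℚ (suc n)) (stirlingCoeffs n) i
stirlingCoeffs-suc n zero    = refl
stirlingCoeffs-suc n (suc i) = refl

stirlingCoeffs-top : ∀ n → stirlingCoeffs n (suc n) ≡ 0ℚ
stirlingCoeffs-top n = signedStirling1-vanishes (s≤s (ℕ.n<1+n n))

x-1-∸-suc : ∀ x n → x - 1ℚ - ℕ→ℚ n ≡ x - ℕ→ℚ (suc n)
x-1-∸-suc x n = trans (solve 2 (λ x m → x :- con 1ℚ :- m := x :- (con 1ℚ :+ m)) refl x (ℕ→ℚ n))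
                      (cong (_-_ x) (sym (ℕ→ℚ-suc n)))

poly-stirlingCoeffs : ∀ n x → poly n (stirlingCoeffs n) x ≡ falling (x - 1ℚ) n
poly-stirlingCoeffs zero    x = refl
poly-stirlingCoeffs (suc n) x = begin
  poly (suc n) (stirlingCoeffs (suc n)) x
    ≡⟨ sumTo-cong (suc n) (λ i _ → cong (_* pow x i) (stirlingCoeffs-suc n i)) ⟩
  poly (suc n) (timesXMinus (ℕ→ℚ (suc n)) (stirlingCoeffs n)) x
    ≡⟨ poly-timesXMinus n (stirlingCoeffs n) (ℕ→ℚ (suc n)) x (stirlingCoeffs-top n) ⟩
  poly n (stirlingCoeffs n) x * (x - ℕ→ℚ (suc n))
    ≡⟨ cong₂ _*_ (poly-stirlingCoeffs n x) (sym (x-1-∸-suc x n)) ⟩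
  falling (x - 1ℚ) (suc n) ∎

poly-deriv-stirlingCoeffs : ∀ n x → poly n (deriv (stirlingCoeffs (suc n))) x ≡ fallingDeriv (x - 1ℚ) (suc n)
poly-deriv-stirlingCoeffs zero    x = sym (trans (cong (_+ 1ℚ) (*-zeroˡ (x - 1ℚ - 0ℚ))) (+-identityˡ 1ℚ))
poly-deriv-stirlingCoeffs (suc n) x = begin
  poly (suc n) (deriv (stirlingCoeffs (suc (suc n)))) x
    ≡⟨ sumTo-cong (suc n) (λ i _ → cong (_* pow x i) (product-rule i)) ⟩
  sumTo (suc n) (λ i → (a i + timesXMinus M a′ i) * pow x i)
    ≡⟨ trans (sumTo-cong (suc n) (λ i _ → *-distribʳ-+ (pow x i) (a i) _)) (sumTo-distrib-+ (suc n) _ _) ⟩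
  poly (suc n) a x + poly (suc n) (timesXMinus M a′) x
    ≡⟨ cong₂ _+_ (poly-stirlingCoeffs (suc n) x) (poly-timesXMinus n a′ M x top≡0) ⟩
  falling (x - 1ℚ) (suc n) + poly n a′ x * (x - M)
    ≡⟨ cong₂ (λ p q → falling (x - 1ℚ) (suc n) + p * q)
             (poly-deriv-stirlingCoeffs n x) (sym (x-1-∸-suc x (suc n))) ⟩
  falling (x - 1ℚ) (suc n) + fallingDeriv (x - 1ℚ) (suc n) * (x - 1ℚ - ℕ→ℚ (suc n))
    ≡⟨ +-comm (falling (x - 1ℚ) (suc n)) _ ⟩
  fallingDeriv (x - 1ℚ) (suc (suc n)) ∎
  where
  M = ℕ→ℚ (suc (suc n))
  a = stirlingCoeffs (suc n)
  a′ = deriv a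
  product-rule : ∀ i → deriv (stirlingCoeffs (suc (suc n))) i ≡ a i + timesXMinus M a′ i
  product-rule i = trans (cong (ℕ→ℚ (suc i) *_) (stirlingCoeffs-suc (suc n) (suc i)))
                         (deriv-timesXMinus M a i)
  top≡0 : a′ (suc n) ≡ 0ℚ
  top≡0 = trans (cong (M *_) (stirlingCoeffs-top (suc n))) (*-zeroʳ M)

-- The derivative of the binomial coefficient

factorial-*-binomQ : ∀ y m → ℕ→ℚ (m !) * binomQ y m ≡ falling y m
factorial-*-binomQ y m = begin
  ℕ→ℚ (m !) * (falling y m * v)
    ≡⟨ solve 3 (λ n f v → n :* (f :* v) := f :* (n :* v)) refl (ℕ→ℚ (m !)) (falling y m) v ⟩
  falling y m * (ℕ→ℚ (m !) * v)
    ≡⟨ cong (falling y m *_) (ℕ→ℚ-inverseʳ (m !) {{m !≢0}}) ⟩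
  falling y m * 1ℚ
    ≡⟨ *-identityʳ (falling y m) ⟩
  falling y m ∎
  where v = _/_ (+ 1) (m !) {{m !≢0}}

binomQ-suc : ∀ y j → binomQ y j * (y - ℕ→ℚ j) ≡ ℕ→ℚ (suc j) * binomQ y (suc j)
binomQ-suc y j = begin
  F * v * (y - J)
    ≡⟨ *-identityʳ _ ⟨
  F * v * (y - J) * 1ℚ
    ≡⟨ cong (F * v * (y - J) *_) (sym (trans (cong (_* w) (sym (ℕ→ℚ-* (suc j) (j !))))
                                             (ℕ→ℚ-inverseʳ (suc j !) {{suc j !≢0}}))) ⟩
  F * v * (y - J) * (N * P * w)
    ≡⟨ solve 7 (λ F v y J N P w → F :* v :* (y :- J) :* (N :* P :* w) := N :* (F :* (y :- J) :* w) :* (P :* v))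
         refl F v y J N P w ⟩
  N * (F * (y - J) * w) * (P * v)
    ≡⟨ cong (N * (F * (y - J) * w) *_) (ℕ→ℚ-inverseʳ (j !) {{j !≢0}}) ⟩
  N * (F * (y - J) * w) * 1ℚ
    ≡⟨ *-identityʳ _ ⟩
  N * binomQ y (suc j) ∎
  where
  F = falling y j
  J = ℕ→ℚ j
  N = ℕ→ℚ (suc j)
  P = ℕ→ℚ (j !)
  v = _/_ (+ 1) (j !) {{j !≢0}}
  w = _/_ (+ 1) (suc j !) {{suc j !≢0}}

sumTo-alternating-telescope : ∀ k (c : ℕ → ℚ) →
  sumTo k (λ j → sgn (k ∸ j) * (c (suc j) + c j)) ≡ c (suc k) + sgn k * c 0
sumTo-alternating-telescope zero    c = solve 2 (λ a b → con 1ℚ :* (a :+ b) := a :+ con 1ℚ :* b) refl (c 1) (c 0)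
sumTo-alternating-telescope (suc k) c = begin
  sumTo k (λ j → sgn (suc k ∸ j) * t j) + sgn (k ∸ k) * t (suc k)
    ≡⟨ cong₂ _+_ (sumTo-cong k (λ j j≤k → trans (cong (_* t j) (sgn-suc-∸ j≤k))
                                                (sym (neg-distribˡ-* (sgn (k ∸ j)) (t j)))))
                 (cong (λ m → sgn m * t (suc k)) (ℕ.n∸n≡0 k)) ⟩
  sumTo k (λ j → - (sgn (k ∸ j) * t j)) + 1ℚ * t (suc k)
    ≡⟨ cong (_+ 1ℚ * t (suc k)) (trans (sumTo-neg k _) (cong -_ (sumTo-alternating-telescope k c))) ⟩
  - (c (suc k) + sgn k * c 0) + 1ℚ * (c (suc (suc k)) + c (suc k))
    ≡⟨ solve 4 (λ a b σ z → :- (b :+ σ :* z) :+ con 1ℚ :* (a :+ b) := a :+ (:- σ) :* z) refl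
         (c (suc (suc k))) (c (suc k)) (sgn k) (c 0) ⟩
  c (suc (suc k)) + sgn (suc k) * c 0 ∎
  where
  t : ℕ → ℚ
  t j = c (suc j) + c j

-- The derivative of y ↦ binomQ y (suc k).
binomQ′ : ℕ → ℚ → ℚ
binomQ′ k y = sumTo k (λ j → sgn (k ∸ j) * ((+ 1) / suc (k ∸ j)) * binomQ y j)

-- d stands for n - 1 - j, fixed by an equation to avoid truncated subtraction.
binomQ′-term : ∀ {j d n} y → j ℕ.+ suc d ≡ n →
               ℕ→ℚ (suc n) * (((+ 1) / suc d) * binomQ y (suc j))
                 ≡ ((+ 1) / suc d) * binomQ y j * (y - ℕ→ℚ n) + (binomQ y (suc j) + binomQ y j)
binomQ′-term {j} {d} y refl = begin
  ℕ→ℚ (suc (j ℕ.+ suc d)) * (ρ * C₁)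
    ≡⟨ cong (_* (ρ * C₁)) (ℕ→ℚ-+ (suc j) (suc d)) ⟩
  (ℕ→ℚ (suc j) + D) * (ρ * C₁)
    ≡⟨ solve 4 (λ N D ρ C₁ → (N :+ D) :* (ρ :* C₁) := ρ :* (N :* C₁) :+ D :* ρ :* C₁) refl
         (ℕ→ℚ (suc j)) D ρ C₁ ⟩
  ρ * (ℕ→ℚ (suc j) * C₁) + D * ρ * C₁
    ≡⟨ cong₂ (λ p q → ρ * p + q * C₁) (sym (binomQ-suc y j)) Dρ≡1 ⟩
  ρ * (C₀ * (y - J)) + 1ℚ * C₁
    ≡⟨ solve 5 (λ ρ C₀ y J C₁ → ρ :* (C₀ :* (y :- J)) :+ con 1ℚ :* C₁
                               := ρ :* C₀ :* (y :- J) :- con 1ℚ :* C₀ :+ (C₁ :+ C₀))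
         refl ρ C₀ y J C₁ ⟩
  ρ * C₀ * (y - J) - 1ℚ * C₀ + (C₁ + C₀)
    ≡⟨ cong (λ u → ρ * C₀ * (y - J) - u * C₀ + (C₁ + C₀)) Dρ≡1 ⟨
  ρ * C₀ * (y - J) - D * ρ * C₀ + (C₁ + C₀)
    ≡⟨ solve 6 (λ ρ C₀ y J D C₁ → ρ :* C₀ :* (y :- J) :- D :* ρ :* C₀ :+ (C₁ :+ C₀)
                                 := ρ :* C₀ :* (y :- (J :+ D)) :+ (C₁ :+ C₀)) refl ρ C₀ y J D C₁ ⟩
  ρ * C₀ * (y - (J + D)) + (C₁ + C₀)
    ≡⟨ cong (λ u → ρ * C₀ * (y - u) + (C₁ + C₀)) (ℕ→ℚ-+ j (suc d)) ⟨
  ρ * C₀ * (y - ℕ→ℚ (j ℕ.+ suc d)) + (C₁ + C₀) ∎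
  where
  ρ = (+ 1) / suc d
  D = ℕ→ℚ (suc d)
  J = ℕ→ℚ j
  C₀ = binomQ y j
  C₁ = binomQ y (suc j)
  Dρ≡1 : D * ρ ≡ 1ℚ
  Dρ≡1 = ℕ→ℚ-inverseʳ (suc d)

binomQ′-suc : ∀ k y →
  ℕ→ℚ (suc (suc k)) * binomQ′ (suc k) y ≡ binomQ′ k y * (y - ℕ→ℚ (suc k)) + binomQ y (suc k)
binomQ′-suc k y = begin
  N * binomQ′ (suc k) y
    ≡⟨ cong (N *_) (sumTo-head k _) ⟩
  N * (sgn (suc k) * r * C 0 + sumTo k t)
    ≡⟨ *-distribˡ-+ N _ (sumTo k t) ⟩
  N * (sgn (suc k) * r * C 0) + N * sumTo k t
    ≡⟨ cong₂ _+_ head-term tail-sum ⟩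
  sgn (suc k) * 1ℚ * C 0 + (binomQ′ k y * d + (C (suc k) + sgn k * C 0))
    ≡⟨ solve 4 (λ σ B c z → (:- σ) :* con 1ℚ :* z :+ (B :+ (c :+ σ :* z)) := B :+ c) refl
         (sgn k) (binomQ′ k y * d) (C (suc k)) (C 0) ⟩
  binomQ′ k y * d + C (suc k) ∎
  where
  N = ℕ→ℚ (suc (suc k))
  r = (+ 1) / suc (suc k)
  d = y - ℕ→ℚ (suc k)
  C = binomQ y
  ρ : ℕ → ℚ
  ρ j = (+ 1) / suc (k ∸ j)
  t : ℕ → ℚ
  t j = sgn (k ∸ j) * ρ j * C (suc j)
  head-term : N * (sgn (suc k) * r * C 0) ≡ sgn (suc k) * 1ℚ * C 0
  head-term = trans (solve 4 (λ N σ r c → N :* (σ :* r :* c) := σ :* (N :* r) :* c) refl N (sgn (suc k)) r (C 0))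
                    (cong (λ u → sgn (suc k) * u * C 0) (ℕ→ℚ-inverseʳ (suc (suc k))))
  summand : ∀ j → j ≤ k → N * t j ≡ sgn (k ∸ j) * ρ j * C j * d + sgn (k ∸ j) * (C (suc j) + C j)
  summand j j≤k = begin
    N * t j
      ≡⟨ solve 4 (λ N σ ρ c → N :* (σ :* ρ :* c) := σ :* (N :* (ρ :* c))) refl
           N (sgn (k ∸ j)) (ρ j) (C (suc j)) ⟩
    sgn (k ∸ j) * (N * (ρ j * C (suc j)))
      ≡⟨ cong (sgn (k ∸ j) *_) (binomQ′-term y j+suc[k∸j]≡suc-k) ⟩
    sgn (k ∸ j) * (ρ j * C j * d + (C (suc j) + C j))
      ≡⟨ solve 5 (λ σ ρ c d e → σ :* (ρ :* c :* d :+ e) := σ :* ρ :* c :* d :+ σ :* e) refl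
           (sgn (k ∸ j)) (ρ j) (C j) d (C (suc j) + C j) ⟩
    sgn (k ∸ j) * ρ j * C j * d + sgn (k ∸ j) * (C (suc j) + C j) ∎
    where
    j+suc[k∸j]≡suc-k : j ℕ.+ suc (k ∸ j) ≡ suc k
    j+suc[k∸j]≡suc-k = trans (ℕ.+-suc j (k ∸ j)) (cong suc (ℕ.m+[n∸m]≡n j≤k))
  tail-sum : N * sumTo k t ≡ binomQ′ k y * d + (C (suc k) + sgn k * C 0)
  tail-sum = begin
    N * sumTo k t
      ≡⟨ trans (*-distribˡ-sumTo k N t) (sumTo-cong k summand) ⟩
    sumTo k (λ j → sgn (k ∸ j) * ρ j * C j * d + sgn (k ∸ j) * (C (suc j) + C j))
      ≡⟨ sumTo-distrib-+ k _ _ ⟩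
    sumTo k (λ j → sgn (k ∸ j) * ρ j * C j * d) + sumTo k (λ j → sgn (k ∸ j) * (C (suc j) + C j))
      ≡⟨ cong₂ _+_ (sym (*-distribʳ-sumTo k d _)) (sumTo-alternating-telescope k C) ⟩
    binomQ′ k y * d + (C (suc k) + sgn k * C 0) ∎

factorial-*-binomQ′ : ∀ k y → ℕ→ℚ (suc k !) * binomQ′ k y ≡ fallingDeriv y (suc k)
factorial-*-binomQ′ zero    y = sym (trans (cong (_+ 1ℚ) (*-zeroˡ (y - 0ℚ))) (+-identityˡ 1ℚ))
factorial-*-binomQ′ (suc k) y = begin
  ℕ→ℚ (suc (suc k) !) * binomQ′ (suc k) y
    ≡⟨ cong (_* binomQ′ (suc k) y) (ℕ→ℚ-* (suc (suc k)) (suc k !)) ⟩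
  N * F * binomQ′ (suc k) y
    ≡⟨ solve 3 (λ N F B → N :* F :* B := F :* (N :* B)) refl N F (binomQ′ (suc k) y) ⟩
  F * (N * binomQ′ (suc k) y)
    ≡⟨ cong (F *_) (binomQ′-suc k y) ⟩
  F * (binomQ′ k y * d + binomQ y (suc k))
    ≡⟨ solve 4 (λ F B d c → F :* (B :* d :+ c) := F :* B :* d :+ F :* c) refl
         F (binomQ′ k y) d (binomQ y (suc k)) ⟩
  F * binomQ′ k y * d + F * binomQ y (suc k)
    ≡⟨ cong₂ (λ p q → p * d + q) (factorial-*-binomQ′ k y) (factorial-*-binomQ y (suc k)) ⟩
  fallingDeriv y (suc (suc k)) ∎
  where
  N = ℕ→ℚ (suc (suc k))
  F = ℕ→ℚ (suc k !)
  d = y - ℕ→ℚ (suc k)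

-- Both sides as the derivative of a falling factorial

stirling1-bernoulliPoly-sum : ∀ n x →
  ℕ→ℚ (suc n) * sumTo n (λ i → signedStirling1 (suc n) (suc i) * bernoulliPoly i x)
    ≡ poly n (deriv (stirlingCoeffs (suc n))) x
stirling1-bernoulliPoly-sum n x = begin
  K * sumTo n (λ i → s (suc n) (suc i) * B i)
    ≡⟨ *-distribˡ-sumTo n K _ ⟩
  sumTo n (λ i → K * (s (suc n) (suc i) * B i))
    ≡⟨ sumTo-extend (λ i → K * (s (suc n) (suc i) * B i)) (ℕ.n≤1+n n) top-vanishes ⟨
  sumTo (suc n) (λ i → K * (s (suc n) (suc i) * B i))
    ≡⟨ trans (sumTo-cong (suc n) (λ i _ → recurrence i)) (sumTo-distrib-- (suc n) _ _) ⟩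
  sumTo (suc n) (λ i → binom-q i * B i) - sumTo (suc n) (λ j → q j * B j)
    ≡⟨ cong (_- sumTo (suc n) (λ j → q j * B j)) (sumTo-binomial-swap (suc n) q B) ⟩
  sumTo (suc n) (λ j → q j * sumTo j (λ i → ℕ→ℚ (j C i) * B i)) - sumTo (suc n) (λ j → q j * B j)
    ≡⟨ sumTo-distrib-- (suc n) _ _ ⟨
  sumTo (suc n) (λ j → q j * sumTo j (λ i → ℕ→ℚ (j C i) * B i) - q j * B j)
    ≡⟨ sumTo-cong (suc n) (λ j _ → difference j) ⟩
  sumTo (suc n) (λ j → q j * (ℕ→ℚ j * pow x (j ∸ 1)))
    ≡⟨ sumTo-derivative n q x ⟩
  poly n (deriv q) x ∎
  where
  s = signedStirling1
  K = ℕ→ℚ (suc n)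
  q = stirlingCoeffs (suc n)
  B : ℕ → ℚ
  B i = bernoulliPoly i x
  binom-q : ℕ → ℚ
  binom-q i = sumTo (suc n) (λ j → ℕ→ℚ (j C i) * q j)
  top-vanishes : ∀ i → n < i → K * (s (suc n) (suc i) * B i) ≡ 0ℚ
  top-vanishes i n<i = trans (cong (λ u → K * (u * B i)) (signedStirling1-vanishes (s≤s n<i)))
                             (solve 2 (λ K b → K :* (con 0ℚ :* b) := con 0ℚ) refl K (B i))
  recurrence : ∀ i → K * (s (suc n) (suc i) * B i) ≡ binom-q i * B i - q i * B i
  recurrence i = begin
    K * (s (suc n) (suc i) * B i)
      ≡⟨ solve 4 (λ K a b β → K :* (b :* β) := (a :- (a :- K :* b)) :* β) refl
           K (s (suc n) i) (s (suc n) (suc i)) (B i) ⟩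
    (s (suc n) i - q i) * B i
      ≡⟨ cong (λ u → (u - q i) * B i) (binomial-sum-signedStirling1 (suc n) i) ⟨
    (binom-q i - q i) * B i
      ≡⟨ solve 3 (λ S q β → (S :- q) :* β := S :* β :- q :* β) refl (binom-q i) (q i) (B i) ⟩
    binom-q i * B i - q i * B i ∎
  difference : ∀ j →
    q j * sumTo j (λ i → ℕ→ℚ (j C i) * B i) - q j * B j ≡ q j * (ℕ→ℚ j * pow x (j ∸ 1))
  difference j = begin
    q j * sumTo j (λ i → ℕ→ℚ (j C i) * B i) - q j * B j
      ≡⟨ cong (λ u → q j * u - q j * B j) (trans (binomial-sum-bernoulliPoly j x) (bernoulliPoly-+1 j x)) ⟩
    q j * (B j + ℕ→ℚ j * pow x (j ∸ 1)) - q j * B j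
      ≡⟨ solve 3 (λ q β d → q :* (β :+ d) :- q :* β := q :* d) refl
           (q j) (B j) (ℕ→ℚ j * pow x (j ∸ 1)) ⟩
    q j * (ℕ→ℚ j * pow x (j ∸ 1)) ∎

mainTheorem4 : (k : ℕ) (x : ℚ) →
    sumTo k (λ j → sgn (k ∸ j) * ℕ→ℚ (stirling1 (suc k) (suc j)) * bernoulliPoly j x)
      ≡ ℕ→ℚ (k !) * sumTo k (λ j → sgn (k ∸ j) * ((+ 1) / suc (k ∸ j)) * binomQ (x - 1ℚ) j)
mainTheorem4 k x = ℕ→ℚ-suc-*-cancelˡ k (begin
  K * sumTo k (λ j → sgn (k ∸ j) * ℕ→ℚ (stirling1 (suc k) (suc j)) * bernoulliPoly j x)
    ≡⟨ cong (K *_) (sumTo-cong k (λ j _ → cong (_* bernoulliPoly j x) (sgn-*-stirling1 (suc k) (suc j)))) ⟩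
  K * sumTo k (λ j → signedStirling1 (suc k) (suc j) * bernoulliPoly j x)
    ≡⟨ stirling1-bernoulliPoly-sum k x ⟩
  poly k (deriv (stirlingCoeffs (suc k))) x
    ≡⟨ poly-deriv-stirlingCoeffs k x ⟩
  fallingDeriv (x - 1ℚ) (suc k)
    ≡⟨ factorial-*-binomQ′ k (x - 1ℚ) ⟨
  ℕ→ℚ (suc k !) * binomQ′ k (x - 1ℚ)
    ≡⟨ trans (cong (_* binomQ′ k (x - 1ℚ)) (ℕ→ℚ-* (suc k) (k !))) (*-assoc K (ℕ→ℚ (k !)) _) ⟩
  K * (ℕ→ℚ (k !) * binomQ′ k (x - 1ℚ)) ∎)
  where
  K = ℕ→ℚ (suc k)
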